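{- There is no IFG$_1$-schema $\xi$ involving two formula variables such that for every pair of IFG$_1$-formulas $\phi$ and $\psi$ and every structure $\mathfrak A$ suitable for them, \[ \mathfrak A \models^+ \xi(\phi,\psi) \quad\text{if and only if}\quad \|\phi\|_{\mathfrak A} = \|\psi\|_{\mathfrak A}. \]
   Context: Teams and operations. For a set $A$ and $N\in\mathbb N$ (identify $N$ with $\{0,\dots,N-1\}$), ${}^NA$ is the set of valuations $\vec a=(a_0,\dots,a_{N-1})$; a team is a subset of ${}^NA$. For $J\subseteq N$, $\vec a\approx_J\vec b$ means $\vec a,\vec b$ agree on all coordinates in $N\setminus J$. For teams, $V=V_1\cup_J V_2$ means $V_1\cup V_2=V$, $V_1\cap V_2=\emptyset$, and each $V_i$ is closed under $\approx_J$ within $V$. A function $f:V\to A$ is independent of $J$ if $f(\vec a)=f(\vec b)$ whenever $\vec a\approx_J\vec b$. For $n<N$, $\vec a(n:b)$ is $\vec a$ with its $n$th coordinate replaced by $b$, $V(n:f)=\{\vec a(n:f(\vec a)):\vec a\in V\}$, and $W(n:A)=\{\vec a(n:b):\vec a\in W,\ b\in A\}$. IFG$_N$-formulas (over a first-order signature with equality) in the variables $v_0,\dots,v_{N-1}$: every atomic first-order formula in these variables is one; if $\phi,\psi$ are, so are $\sim\phi$, $\phi\vee_{/J}\psi$ ($J\subseteq N$) and $(\exists v_n/J)\phi$ ($n<N$, $J\subseteq N$). For a structure $\mathfrak A$ with universe $A$ and teams $V,W\subseteq{}^NA$, the relations $\mathfrak A\models^+\phi[V]$ (true relative to $V$) and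 $\mathfrak A\models^-\phi[W]$ (false relative to $W$) are defined by: for atomic $\phi$, $\mathfrak A\models^+\phi[V]$ iff every $\vec a\in V$ satisfies $\phi$ in the usual sense, and $\mathfrak A\models^-\phi[W]$ iff no $\vec b\in W$ satisfies $\phi$; $\mathfrak A\models^\pm\sim\psi[V]$ iff $\mathfrak A\models^\mp\psi[V]$; $\mathfrak A\models^+\psi_1\vee_{/J}\psi_2[V]$ iff $\mathfrak A\models^+\psi_1[V_1]$ and $\mathfrak A\models^+\psi_2[V_2]$ for some $V=V_1\cup_JV_2$, and $\mathfrak A\models^-\psi_1\vee_{/J}\psi_2[W]$ iff $\mathfrak A\models^-\psi_1[W]$ and $\mathfrak A\models^-\psi_2[W]$; $\mathfrak A\models^+(\exists v_n/J)\psi[V]$ iff $\mathfrak A\models^+\psi[V(n:f)]$ for some $f:V\to A$ independent of $J$, and $\mathfrak A\models^-(\exists v_n/J)\psi[W]$ iff $\mathfrak A\models^-\psi[W(n:A)]$. Write $\mathfrak A\models^\pm\phi$ for $\mathfrak A\models^\pm\phi[{}^NA]$. The meaning of $\phi$ is $\|\phi\|_{\mathfrak A}=\langle\{V:\mathfrak A\models^+\phi[V]\},\{W:\mathfrak A\models^-\phi[W]\}\rangle$. An IFG$_N$-schema involving $k$ formula variables is an element of the smallest set containing the formula variables $\alpha_0,\dots,\alpha_{k-1}$ (symbols distinct from the $v_i$) and the formulas $v_i=v_j$ ($i,j<N$), and closed under $\xi\mapsto\sim\xi$, $(\xi_1,\xi_2)\mapsto\xi_1\vee_{/J}\xi_2$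 ($J\subseteq N$) and $\xi\mapsto(\exists v_n/J)\xi$ ($n<N$, $J\subseteq N$). For IFG$_N$-formulas $\phi_0,\dots,\phi_{k-1}$, $\xi(\phi_0,\dots,\phi_{k-1})$ denotes the IFG$_N$-formula obtained by substituting $\phi_i$ for $\alpha_i$. -}

module Defs where

open import Level using (Lift)
open import Data.Nat using (ℕ)
open import Data.Fin using (Fin; zero; suc)
open import Data.Fin.Subset using (Subset; _∉_)
open import Data.Vec using (Vec; lookup; _[_]≔_)
open import Data.Product using (Σ; _×_; _,_)
open import Data.Sum using (_⊎_)
open import Data.Unit using (⊤)
open import Data.Empty using (⊥)
open import Relation.Nullary using (¬_)
open import Relation.Binary.PropositionalEquality using (_≡_)
open import Function.Bundles using (_⇔_)

record Signature : Set₁ where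
  field
    FunSym   : Set
    funArity : FunSym → ℕ
    RelSym   : Set
    relArity : RelSym → ℕ
open Signature public

data Term (σ : Signature) (N : ℕ) : Set where
  var : Fin N → Term σ N
  app : (f : FunSym σ) → (Fin (funArity σ f) → Term σ N) → Term σ N

-- IFG_N-formulas.  J : Subset N plays the role of J ⊆ N.
data Formula (σ : Signature) (N : ℕ) : Set where
  _≐_  : Term σ N → Term σ N → Formula σ N
  rel  : (r : RelSym σ) → (Fin (relArity σ r) → Term σ N) → Formula σ N
  ∼_   : Formula σ N → Formula σ N
  ∨/   : Subset N → Formula σ N → Formula σ N → Formula σ N
  ∃/   : Fin N → Subset N → Formula σ N → Formula σ N        -- (∃ v_n / J) φ

-- Structures (with nonempty universe, as usual for first-order structures)
record Structure (σ : Signature) : Set₁ where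
  field
    Carrier    : Set
    inhabitant : Carrier
    funI       : (f : FunSym σ) → (Fin (funArity σ f) → Carrier) → Carrier
    relI       : (r : RelSym σ) → (Fin (relArity σ r) → Carrier) → Set
open Structure public

module Semantics {σ : Signature} (𝔄 : Structure σ) {N : ℕ} where

  A : Set
  A = Carrier 𝔄

  Val : Set
  Val = Vec A N

  Team : Set₁
  Team = Val → Set

  full : Team
  full _ = ⊤

  ⟦_⟧ : Term σ N → Val → A
  ⟦ var i ⟧ a = lookup a i
  ⟦ app f ts ⟧ a = funI 𝔄 f (λ i → ⟦ ts i ⟧ a)

  _≈[_]_ : Val → Subset N → Val → Set
  a ≈[ J ] b = ∀ i → i ∉ J → lookup a i ≡ lookup b i

  record Split (J : Subset N) (V V₁ V₂ : Team) : Set where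
    field
      cover    : ∀ a → V a ⇔ (V₁ a ⊎ V₂ a)
      disjoint : ∀ a → V₁ a → V₂ a → ⊥
      closed₁  : ∀ a b → V a → V b → a ≈[ J ] b → V₁ a → V₁ b
      closed₂  : ∀ a b → V a → V b → a ≈[ J ] b → V₂ a → V₂ b

  FunOn : Team → Set
  FunOn V = (a : Val) → V a → A

  IndependentOf : (J : Subset N) (V : Team) → FunOn V → Set
  IndependentOf J V f = ∀ a b (p : V a) (q : V b) → a ≈[ J ] b → f a p ≡ f b q

  updF : (V : Team) → Fin N → FunOn V → Team
  updF V n f c = Σ Val λ a → Σ (V a) λ p → c ≡ (a [ n ]≔ f a p)

  updA : Team → Fin N → Team
  updA W n c = Σ Val λ a → W a × Σ A λ b → c ≡ (a [ n ]≔ b)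

  sat⁺ : Formula σ N → Team → Set₁
  sat⁻ : Formula σ N → Team → Set₁
  sat⁺ (t ≐ u) V = Lift _ (∀ a → V a → ⟦ t ⟧ a ≡ ⟦ u ⟧ a)
  sat⁺ (rel r ts) V = Lift _ (∀ a → V a → relI 𝔄 r (λ i → ⟦ ts i ⟧ a))
  sat⁺ (∼ φ) V = sat⁻ φ V
  sat⁺ (∨/ J φ ψ) V =
    Σ Team λ V₁ → Σ Team λ V₂ → Split J V V₁ V₂ × sat⁺ φ V₁ × sat⁺ ψ V₂
  sat⁺ (∃/ n J φ) V =
    Σ (FunOn V) λ f → IndependentOf J V f × sat⁺ φ (updF V n f)
  sat⁻ (t ≐ u) W = Lift _ (∀ b → W b → ¬ (⟦ t ⟧ b ≡ ⟦ u ⟧ b))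
  sat⁻ (rel r ts) W = Lift _ (∀ b → W b → ¬ relI 𝔄 r (λ i → ⟦ ts i ⟧ b))
  sat⁻ (∼ φ) W = sat⁺ φ W
  sat⁻ (∨/ J φ ψ) W = sat⁻ φ W × sat⁻ ψ W
  sat⁻ (∃/ n J φ) W = sat⁻ φ (updA W n)

  Sat⁺ : Formula σ N → Set₁
  Sat⁺ φ = sat⁺ φ full

  SameMeaning : Formula σ N → Formula σ N → Set₁
  SameMeaning φ ψ = (∀ V → sat⁺ φ V ⇔ sat⁺ ψ V) × (∀ W → sat⁻ φ W ⇔ sat⁻ ψ W)

data Schema (N k : ℕ) : Set where
  α    : Fin k → Schema N k
  eqv  : Fin N → Fin N → Schema N k
  ∼ₛ   : Schema N k → Schema N k
  ∨/ₛ  : Subset N → Schema N k → Schema N k → Schema N k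
  ∃/ₛ  : Fin N → Subset N → Schema N k → Schema N k

inst : ∀ {σ N k} → Schema N k → (Fin k → Formula σ N) → Formula σ N
inst (α i) φs = φs i
inst (eqv i j) φs = var i ≐ var j
inst (∼ₛ ξ) φs = ∼ inst ξ φs
inst (∨/ₛ J ξ₁ ξ₂) φs = ∨/ J (inst ξ₁ φs) (inst ξ₂ φs)
inst (∃/ₛ n J ξ) φs = ∃/ n J (inst ξ φs)

args₂ : ∀ {σ N} → Formula σ N → Formula σ N → Fin 2 → Formula σ N
args₂ φ ψ zero = φ
args₂ φ ψ (suc zero) = ψ

inst₂ : ∀ {σ N} → Schema N 2 → Formula σ N → Formula σ N → Formula σ N
inst₂ ξ φ ψ = inst ξ (args₂ φ ψ)

module Submission where

-- Call φ ⊑ ψ ("the meaning of φ is included in that of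
-- ψ") when every team on which φ is true makes ψ true and every team on which
-- φ is false makes ψ false.  Every schema is monotone with respect to ⊑ in
-- each of its formula variables: the clauses for ∼, ∨_{/J} and ∃ only pass
-- teams to the arguments unchanged or construct them from the outer team, and
-- ∼ swaps truth and falsity in both sides of ⊑ at once.
--
-- Suppose ξ(φ, ψ) were true exactly when ‖φ‖ = ‖ψ‖.  Then ξ(θ, θ) is true,
-- so by monotonicity ξ(θ, θ') is true whenever θ ⊑ θ', whence ‖θ‖ = ‖θ'‖.
-- This fails for θ = P(v₀) ∨_{/{0}} ∼P(v₀) and θ' = (v₀ = v₀) in the two
-- element structure where P holds of exactly one element: θ ⊑ θ' (θ' is true
-- on every team, and both are false only on the empty team), θ' is true on
-- the full team, but θ is not, since a split closed under ≈_{0} cannot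
-- separate the two valuations.

open import Defs
open import Data.Product using (Σ; _,_; proj₁; proj₂; _×_)
open import Relation.Nullary using (¬_)
open import Function.Bundles using (_⇔_; Equivalence; mk⇔)
open import Data.Nat using (ℕ)
open import Data.Fin using (Fin; zero; suc)
open import Data.Fin.Subset using (inside)
open import Data.Vec using ([]; _∷_; here)
open import Data.Bool using (Bool; true; false)
open import Data.Unit using (⊤; tt)
open import Data.Empty using (⊥; ⊥-elim)
open import Data.Sum using (inj₁; inj₂)
open import Level using (lift)
open import Relation.Binary.PropositionalEquality using (_≡_; refl)

module Inclusion {σ : Signature} (𝔄 : Structure σ) {N : ℕ} where
  open Semantics 𝔄 {N}

  _⊑_ : Formula σ N → Formula σ N → Set₁
  φ ⊑ ψ = (∀ V → sat⁺ φ V → sat⁺ ψ V) × (∀ W → sat⁻ φ W → sat⁻ ψ W)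

  ⊑-refl : ∀ φ → φ ⊑ φ
  ⊑-refl φ = (λ V s → s) , (λ W s → s)

  sameMeaning-refl : ∀ φ → SameMeaning φ φ
  sameMeaning-refl φ = (λ V → mk⇔ (λ s → s) (λ s → s)) , (λ W → mk⇔ (λ s → s) (λ s → s))

  sameMeaning⇒⊒ : ∀ {φ ψ} → SameMeaning φ ψ → ψ ⊑ φ
  sameMeaning⇒⊒ (same⁺ , same⁻) =
    (λ V → Equivalence.from (same⁺ V)) , (λ W → Equivalence.from (same⁻ W))

  -- Schemas are monotone in their formula variables with respect to ⊑;
  -- truth and falsity are handled simultaneously because ∼ exchanges them.
  module _ {k : ℕ} (φs φs' : Fin k → Formula σ N) (φs⊑φs' : ∀ i → φs i ⊑ φs' i) where
    inst-mono⁺ : ∀ ξ V → sat⁺ (inst ξ φs) V → sat⁺ (inst ξ φs') V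
    inst-mono⁻ : ∀ ξ W → sat⁻ (inst ξ φs) W → sat⁻ (inst ξ φs') W
    inst-mono⁺ (α i) V s = proj₁ (φs⊑φs' i) V s
    inst-mono⁺ (eqv i j) V s = s
    inst-mono⁺ (∼ₛ ξ) V s = inst-mono⁻ ξ V s
    inst-mono⁺ (∨/ₛ J ξ₁ ξ₂) V (V₁ , V₂ , split , s₁ , s₂) =
      V₁ , V₂ , split , inst-mono⁺ ξ₁ V₁ s₁ , inst-mono⁺ ξ₂ V₂ s₂
    inst-mono⁺ (∃/ₛ n J ξ) V (f , indep , s) = f , indep , inst-mono⁺ ξ _ s
    inst-mono⁻ (α i) W s = proj₂ (φs⊑φs' i) W s
    inst-mono⁻ (eqv i j) W s = s
    inst-mono⁻ (∼ₛ ξ) W s = inst-mono⁺ ξ W s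
    inst-mono⁻ (∨/ₛ J ξ₁ ξ₂) W (s₁ , s₂) = inst-mono⁻ ξ₁ W s₁ , inst-mono⁻ ξ₂ W s₂
    inst-mono⁻ (∃/ₛ n J ξ) W s = inst-mono⁻ ξ _ s

  inst₂-mono : ∀ ξ φ {ψ ψ'} → ψ ⊑ ψ' → Sat⁺ (inst₂ ξ φ ψ) → Sat⁺ (inst₂ ξ φ ψ')
  inst₂-mono ξ φ {ψ} {ψ'} ψ⊑ψ' = inst-mono⁺ (args₂ φ ψ) (args₂ φ ψ') args⊑ ξ full
    where
    args⊑ : ∀ i → args₂ φ ψ i ⊑ args₂ φ ψ' i
    args⊑ zero = ⊑-refl φ
    args⊑ (suc zero) = ψ⊑ψ'

σ₀ : Signature
σ₀ = record { FunSym = ⊥ ; funArity = λ () ; RelSym = ⊤ ; relArity = λ _ → 1 }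

𝔄₀ : Structure σ₀
𝔄₀ = record
  { Carrier = Bool ; inhabitant = true ; funI = λ () ; relI = λ _ xs → xs zero ≡ true }

open Semantics 𝔄₀ {1}
open Inclusion 𝔄₀ {1}

P : Formula σ₀ 1
P = rel tt (λ _ → var zero)

θ : Formula σ₀ 1
θ = ∨/ (inside ∷ []) P (∼ P)

θ' : Formula σ₀ 1
θ' = var zero ≐ var zero

θ'-true : Sat⁺ θ'
θ'-true = lift (λ a _ → refl)

-- θ' is true on every team, and a team on which θ is false is one on which
-- P is both false and true, hence empty, hence a team on which θ' is false.
θ⊑θ' : θ ⊑ θ'
θ⊑θ' = (λ V _ → lift (λ a _ → refl))
     , (λ W → λ { (lift notP , lift isP) → lift (λ b Wb _ → notP b Wb (isP b Wb)) })

true≈false : (true ∷ []) ≈[ inside ∷ [] ] (false ∷ [])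
true≈false zero 0∉ = ⊥-elim (0∉ here)

-- θ is not true on the full team: the part of a {0}-closed split containing
-- (true) also contains (false), so it can satisfy neither P nor ∼P.
θ-not-true : ¬ Sat⁺ θ
θ-not-true (V₁ , V₂ , split , lift allP , lift noP)
  with Equivalence.to (Split.cover split (true ∷ [])) tt
... | inj₂ true∈V₂ = noP _ true∈V₂ refl
... | inj₁ true∈V₁
  with allP _ (Split.closed₁ split (true ∷ []) (false ∷ []) tt tt true≈false true∈V₁)
... | ()

mainTheorem1 : ¬ (Σ (Schema 1 2) λ ξ →
    (σ : Signature) (𝔄 : Structure σ) (φ ψ : Formula σ 1) →
    Semantics.Sat⁺ 𝔄 (inst₂ ξ φ ψ) ⇔ Semantics.SameMeaning 𝔄 φ ψ)
mainTheorem1 (ξ , expresses) = θ-not-true (proj₁ θ'⊑θ full θ'-true)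
  where
  ξθθ : Sat⁺ (inst₂ ξ θ θ)
  ξθθ = Equivalence.from (expresses σ₀ 𝔄₀ θ θ) (sameMeaning-refl θ)
  ξθθ' : Sat⁺ (inst₂ ξ θ θ')
  ξθθ' = inst₂-mono ξ θ θ⊑θ' ξθθ
  θ'⊑θ : θ' ⊑ θ
  θ'⊑θ = sameMeaning⇒⊒ {θ} {θ'} (Equivalence.to (expresses σ₀ 𝔄₀ θ θ') ξθθ')
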